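{- Let $\mathrel{\vdash\!\dashv}$, $\to$, $\leadsto$ be relations on a set $A$ such that $\mathrel{\vdash\!\dashv}$ is symmetric, ${\leadsto} \subseteq {\mathrel{\vdash\!\dashv}}$, and ${\to} \circ {\stackrel{*}{\leadsto}}$ is well-founded. Let ${\Rightarrow} = {\to} \cup {\leadsto}$. Suppose (i) ${\gets} \circ {\to} \subseteq {\stackrel{*}{\Rightarrow}} \circ {\stackrel{=}{\vdash\!\dashv}} \circ {\stackrel{*}{\Leftarrow}}$, and (ii) ${\mathrel{\vdash\!\dashv}} \circ {\to} \subseteq {\to} \circ {\stackrel{*}{\Rightarrow}} \circ {\stackrel{=}{\vdash\!\dashv}} \circ {\stackrel{*}{\Leftarrow}}$. Then $\to$ is Church-Rosser modulo $\stackrel{*}{\vdash\!\dashv}$.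
   Context: For a relation $R$ on $A$: a reversed arrow ($\gets$, $\Leftarrow$) denotes the inverse; $\stackrel{=}{R}$ the reflexive closure; $\stackrel{*}{R}$ the reflexive-transitive closure. Composition: $a\,(R\circ S)\,c$ iff $\exists b$ with $a\,R\,b$ and $b\,S\,c$. $R$ is well-founded if there is no infinite chain $a_0\,R\,a_1\,R\cdots$. Given an equivalence relation $\sim$, $\to$ is Church-Rosser modulo $\sim$ if $\stackrel{*}{\bowtie} \subseteq \stackrel{*}{\to}\circ \sim \circ \stackrel{*}{\gets}$ where ${\bowtie} = {\leftrightarrow}\cup{\sim}$ and $\leftrightarrow$ is the symmetric closure of $\to$. -}

module Defs where

open import Level using (Level; _⊔_)
open import Data.Nat using (ℕ; suc)
open import Data.Empty using (⊥)
open import Function using (flip)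
open import Relation.Binary.Core using (Rel)
open import Relation.Binary.Construct.Union using (_∪_)
open import Data.Product using (∃; _×_)
open import Relation.Binary.Construct.Closure.ReflexiveTransitive using (Star)

-- Well-foundedness of R in the paper's orientation (no infinite chain
-- a₀ R a₁ R ⋯): every element is accessible w.r.t. the inverse of R
-- (stdlib's WellFounded _<_ forbids infinite descent along _<_).
open import Induction.WellFounded using (WellFounded)
WellFoundedChains : ∀ {a ℓ} {A : Set a} → Rel A ℓ → Set (a ⊔ ℓ)
WellFoundedChains R = WellFounded (flip R)

SymClosure : ∀ {a ℓ} {A : Set a} → Rel A ℓ → Rel A ℓ
SymClosure R = R ∪ flip R

ChurchRosserModulo : ∀ {a ℓ₁ ℓ₂} {A : Set a} → Rel A ℓ₁ → Rel A ℓ₂ → Set (a ⊔ ℓ₁ ⊔ ℓ₂)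
ChurchRosserModulo {A = A} _⟶_ _∼_ =
  ∀ {x y : A} → Star (SymClosure _⟶_ ∪ _∼_) x y →
  ∃₃ x y
  where
    ∃₃ : A → A → Set _
    ∃₃ x y = ∃ λ u → ∃ λ v → Star _⟶_ x u × (u ∼ v) × Star (flip _⟶_) v y

infixr 9 _∘ᵣ_
_∘ᵣ_ : ∀ {a ℓ₁ ℓ₂} {A : Set a} → Rel A ℓ₁ → Rel A ℓ₂ → Rel A (a ⊔ ℓ₁ ⊔ ℓ₂)
R ∘ᵣ S = λ x z → ∃ λ y → R x y × S y z

module Submission where

-- A conversion is a path of steps x ⟶ y, x ⟵ y and x ⊢⊣ y.  Weigh a ⟶-step
-- by its source, and a ⊢⊣-step by both endpoints; the measure of a conversion
-- is its list of weights.  Elements are ordered by e ⊏ t iff t R⁺ e, where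
-- R = ⟶ ∘ ⇝*, which is well-founded by hypothesis; weights, and then
-- measures, are ordered by the (list) multiset extension, again well-founded.
-- A conversion that is not a valley ⟶* ⊢⊣* ⟵* contains a peak ⟵ ⟶, a cliff
-- ⊢⊣ ⟶ or a mirror ⟵ ⊢⊣.  Hypotheses (i) and (ii) rewrite each such pattern
-- into a conversion all of whose weights lie below the pattern's weights,
-- since every element (⟶ ∪ ⇝)-reachable from a ⟶-successor of t lies
-- below t.
-- Well-founded induction on the measure then turns every conversion into a
-- valley.

open import Defs
open import Level using (_⊔_)
open import Function using (flip; id)
open import Relation.Binary.Core using (Rel; _⇒_)
open import Relation.Binary.Definitions using (Symmetric)
open import Relation.Binary.Construct.Union using (_∪_)
open import Relation.Binary.Construct.Closure.Reflexive using (ReflClosure; refl; [_])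
open import Relation.Binary.Construct.Closure.ReflexiveTransitive using (Star; ε; _◅_; _◅◅_; reverse)
import Relation.Binary.Construct.Closure.ReflexiveTransitive as Star
open import Relation.Binary.Construct.Closure.Transitive as Plus using (TransClosure)
open import Data.List using (List; []; _∷_; _++_)
open import Data.List.Properties using (++-identityʳ)
open import Data.List.Relation.Unary.All using (All; []; _∷_)
open import Data.Product using (Σ; ∃; _×_; _,_; proj₁)
open import Data.Sum using (inj₁; inj₂)
open import Induction.WellFounded using (WellFounded; Acc; acc; WfRec)
open import Relation.Binary.PropositionalEquality using (_≡_; refl; cong; subst; sym)

-- The multiset extension of an order, on lists: one step replaces a single
-- entry a by a list of entries each below a (in place); the order is the
-- transitive closure of such steps.
module ListMultisetOrder {b ℓ} {B : Set b} (_<_ : Rel B ℓ) where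

  infix 4 _◁_ _◁⁺_

  data _◁_ : Rel (List B) (b ⊔ ℓ) where
    replace : ∀ {a xs ys} → All (_< a) ys → (ys ++ xs) ◁ (a ∷ xs)
    keep    : ∀ {a xs ys} → ys ◁ xs → (a ∷ ys) ◁ (a ∷ xs)

  _◁⁺_ : Rel (List B) (b ⊔ ℓ)
  _◁⁺_ = TransClosure _◁_

  -- a ∷ xs is accessible when a and xs are: lexicographic induction on the
  -- accessibility of a and of xs.  Replacing the head a puts elements below a,
  -- hence accessible ones, in front of xs.
  acc-∷ : ∀ {a xs} → Acc _<_ a → Acc _◁_ xs → Acc _◁_ (a ∷ xs)
  acc-∷-step : ∀ {a xs} → Acc _<_ a → WfRec _◁_ (Acc _◁_) xs → WfRec _◁_ (Acc _◁_) (a ∷ xs)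
  acc-below : ∀ {a xs ys} → WfRec _<_ (Acc _<_) a → Acc _◁_ xs →
              All (_< a) ys → Acc _◁_ (ys ++ xs)

  acc-∷ acc-a (acc below-xs) = acc (acc-∷-step acc-a below-xs)

  acc-∷-step (acc below-a) below-xs (replace ys<a) = acc-below below-a (acc below-xs) ys<a
  acc-∷-step acc-a         below-xs (keep ys◁xs)   = acc-∷ acc-a (below-xs ys◁xs)

  acc-below below-a acc-xs []           = acc-xs
  acc-below below-a acc-xs (y<a ∷ ys<a) = acc-∷ (below-a y<a) (acc-below below-a acc-xs ys<a)

  wellFounded : WellFounded _<_ → WellFounded _◁⁺_
  wellFounded wf = Plus.wellFounded _◁_ ◁-wellFounded
    where
    ◁-wellFounded : WellFounded _◁_
    ◁-wellFounded []       = acc λ ()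
    ◁-wellFounded (a ∷ xs) = acc-∷ (wf a) (◁-wellFounded xs)

  prefix₁ : ∀ zs {xs ys} → ys ◁ xs → (zs ++ ys) ◁ (zs ++ xs)
  prefix₁ []       p = p
  prefix₁ (z ∷ zs) p = keep (prefix₁ zs p)

  prefix : ∀ zs {xs ys} → ys ◁⁺ xs → (zs ++ ys) ◁⁺ (zs ++ xs)
  prefix zs Plus.[ p ]    = Plus.[ prefix₁ zs p ]
  prefix zs (p Plus.∷ ps) = prefix₁ zs p Plus.∷ prefix zs ps

  drop-head : ∀ {a xs} → xs ◁⁺ (a ∷ xs)
  drop-head = Plus.[ replace [] ]

  replace-first : ∀ {a b xs ys} → All (_< a) ys → (ys ++ xs) ◁⁺ (a ∷ b ∷ xs)
  replace-first {ys = ys} ys<a = prefix ys drop-head Plus.++ Plus.[ replace ys<a ]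

  replace-second : ∀ {a b xs ys} → All (_< b) ys → (ys ++ xs) ◁⁺ (a ∷ b ∷ xs)
  replace-second ys<b = replace ys<b Plus.∷ drop-head

  below-sole : ∀ {a ys} → All (_< a) ys → ys ◁⁺ (a ∷ [])
  below-sole {ys = ys} ys<a = subst (_◁⁺ _) (++-identityʳ ys) Plus.[ replace ys<a ]

  below-first : ∀ {a b ys} → All (_< a) ys → ys ◁⁺ (a ∷ b ∷ [])
  below-first {ys = ys} ys<a = subst (_◁⁺ _) (++-identityʳ ys) (replace-first ys<a)

  below-second : ∀ {a b ys} → All (_< b) ys → ys ◁⁺ (a ∷ b ∷ [])
  below-second {ys = ys} ys<b = subst (_◁⁺ _) (++-identityʳ ys) (replace-second ys<b)

  below-each : ∀ {a b a′ b′} → a′ < a → b′ < b → (a′ ∷ b′ ∷ []) ◁⁺ (a ∷ b ∷ [])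
  below-each a′<a b′<b = replace (a′<a ∷ []) Plus.∷ Plus.[ keep (replace (b′<b ∷ [])) ]

  first-of-two : ∀ {a b} → (a ∷ []) ◁⁺ (a ∷ b ∷ [])
  first-of-two = Plus.[ keep (replace []) ]

  second-of-two : ∀ {a b} → (b ∷ []) ◁⁺ (a ∷ b ∷ [])
  second-of-two = drop-head

module ChurchRosser {a ℓ₁ ℓ₂ ℓ₃} {A : Set a}
  (_⊢⊣_ : Rel A ℓ₁) (_⟶_ : Rel A ℓ₂) (_⇝_ : Rel A ℓ₃)
  (⊢⊣-sym : Symmetric _⊢⊣_) (⇝⊆⊢⊣ : _⇝_ ⇒ _⊢⊣_)
  (R-wf : WellFoundedChains (_⟶_ ∘ᵣ Star _⇝_))
  (local-confluence : (flip _⟶_ ∘ᵣ _⟶_) ⇒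
     (Star (_⟶_ ∪ _⇝_) ∘ᵣ ReflClosure _⊢⊣_ ∘ᵣ Star (flip (_⟶_ ∪ _⇝_))))
  (local-coherence : (_⊢⊣_ ∘ᵣ _⟶_) ⇒
     (_⟶_ ∘ᵣ Star (_⟶_ ∪ _⇝_) ∘ᵣ ReflClosure _⊢⊣_ ∘ᵣ Star (flip (_⟶_ ∪ _⇝_))))
  where

  _⇛_ : Rel A (ℓ₂ ⊔ ℓ₃)
  _⇛_ = _⟶_ ∪ _⇝_

  Join : Rel A (a ⊔ ℓ₁ ⊔ ℓ₂ ⊔ ℓ₃)
  Join = Star _⇛_ ∘ᵣ ReflClosure _⊢⊣_ ∘ᵣ Star (flip _⇛_)

  join-sym : ∀ {x z} → Join x z → Join z x
  join-sym (p , x⇛*p , q , p⊢⊣q , z⇛*q) =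
    q , reverse id z⇛*q , p , ⊢⊣⁼-sym p⊢⊣q , reverse id x⇛*p
    where
    ⊢⊣⁼-sym : ∀ {p q} → ReflClosure _⊢⊣_ p q → ReflClosure _⊢⊣_ q p
    ⊢⊣⁼-sym refl      = refl
    ⊢⊣⁼-sym [ p⊢⊣q ]  = [ ⊢⊣-sym p⊢⊣q ]

  infix 4 _⊏_
  _⊏_ : Rel A (a ⊔ ℓ₂ ⊔ ℓ₃)
  _⊏_ = TransClosure (flip (_⟶_ ∘ᵣ Star _⇝_))

  -- Everything ⇛-reachable from an R-successor of t lies below t: a ⇝-step
  -- extends the current R-step, a ⟶-step starts a new one.
  R-reach-below : ∀ {t b e} → (_⟶_ ∘ᵣ Star _⇝_) t b → Star _⇛_ b e → e ⊏ t
  R-reach-below t-R-b ε = Plus.[ t-R-b ]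
  R-reach-below (m , t⟶m , m⇝*b) (inj₂ b⇝c ◅ c⇛*e) =
    R-reach-below (m , t⟶m , m⇝*b ◅◅ (b⇝c ◅ ε)) c⇛*e
  R-reach-below t-R-b (inj₁ b⟶c ◅ c⇛*e) =
    R-reach-below (_ , b⟶c , ε) c⇛*e Plus.++ Plus.[ t-R-b ]

  Under : A → A → Set (a ⊔ ℓ₂ ⊔ ℓ₃)
  Under t b = ∀ {e} → Star _⇛_ b e → e ⊏ t

  ⟶-under : ∀ {t b} → t ⟶ b → Under t b
  ⟶-under t⟶b = R-reach-below (_ , t⟶b , ε)

  module WeightOrder = ListMultisetOrder _⊏_
  open WeightOrder using () renaming (_◁⁺_ to _<w_)
  module MeasureOrder = ListMultisetOrder _<w_
  open MeasureOrder using () renaming (_◁⁺_ to _≺_)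

  ≺-wellFounded : WellFounded _≺_
  ≺-wellFounded = MeasureOrder.wellFounded (WeightOrder.wellFounded
    (Plus.wellFounded (flip (_⟶_ ∘ᵣ Star _⇝_)) R-wf))

  data Step : Rel A (a ⊔ ℓ₁ ⊔ ℓ₂) where
    fwd : ∀ {x y} → x ⟶ y → Step x y
    bwd : ∀ {x y} → y ⟶ x → Step x y
    eqv : ∀ {x y} → x ⊢⊣ y → Step x y

  weight : ∀ {x y} → Step x y → List A
  weight {x}     (fwd _) = x ∷ []
  weight {y = y} (bwd _) = y ∷ []
  weight {x} {y} (eqv _) = x ∷ y ∷ []

  Conv : Rel A (a ⊔ ℓ₁ ⊔ ℓ₂)
  Conv = Star Step

  measure : ∀ {x z} → Conv x z → List (List A)
  measure ε       = []
  measure (s ◅ c) = weight s ∷ measure c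

  measure-◅◅ : ∀ {x y z} (c : Conv x y) (d : Conv y z) →
               measure (c ◅◅ d) ≡ measure c ++ measure d
  measure-◅◅ ε       d = refl
  measure-◅◅ (s ◅ c) d = cong (weight s ∷_) (measure-◅◅ c d)

  StepUnder : A → Rel A (a ⊔ ℓ₁ ⊔ ℓ₂ ⊔ ℓ₃)
  StepUnder t x y = Σ (Step x y) λ s → All (_⊏ t) (weight s)

  StepBelow : List A → Rel A (a ⊔ ℓ₁ ⊔ ℓ₂ ⊔ ℓ₃)
  StepBelow W x y = Σ (Step x y) λ s → weight s <w W

  step-under-sym : ∀ {t x y} → StepUnder t x y → StepUnder t y x
  step-under-sym (fwd s , x⊏t)             = bwd s , x⊏t
  step-under-sym (bwd s , y⊏t)             = fwd s , y⊏t
  step-under-sym (eqv s , x⊏t ∷ y⊏t ∷ []) = eqv (⊢⊣-sym s) , y⊏t ∷ x⊏t ∷ []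

  forget : ∀ {W x z} → Star (StepBelow W) x z → Conv x z
  forget = Star.map proj₁

  forget-below : ∀ {W x z} (c : Star (StepBelow W) x z) → All (_<w W) (measure (forget c))
  forget-below ε               = []
  forget-below ((_ , s<W) ◅ c) = s<W ∷ forget-below c

  Dominates : List A → A → Set (a ⊔ ℓ₂ ⊔ ℓ₃)
  Dominates W t = ∀ {ys} → All (_⊏ t) ys → ys <w W

  descend : ∀ {t b p} → Under t b → Star _⇛_ b p → Star (StepUnder t) b p
  descend b<t ε                  = ε
  descend b<t (inj₁ b⟶c ◅ c⇛*p) =
    (fwd b⟶c , b<t ε ∷ []) ◅ descend (λ r → b<t (inj₁ b⟶c ◅ r)) c⇛*p
  descend b<t (inj₂ b⇝c ◅ c⇛*p) =
    (eqv (⇝⊆⊢⊣ b⇝c) , b<t ε ∷ b<t (inj₂ b⇝c ◅ ε) ∷ []) ◅ descend (λ r → b<t (inj₂ b⇝c ◅ r)) c⇛*p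

  join-below : ∀ {W tx tz x z} → Dominates W tx → Dominates W tz →
               (∀ {p q} → p ⊏ tx → q ⊏ tz → (p ∷ q ∷ []) <w W) →
               Under tx x → Under tz z → Join x z → Star (StepBelow W) x z
  join-below {W} W≻tx W≻tz W≻pair x<tx z<tz (p , x⇛*p , q , p⊢⊣⁼q , z⇛*q) =
    lift W≻tx (descend x<tx x⇛*p) ◅◅ middle p⊢⊣⁼q ◅◅
    lift W≻tz (reverse step-under-sym (descend z<tz (reverse id z⇛*q)))
    where
    lift : ∀ {t x y} → Dominates W t → Star (StepUnder t) x y → Star (StepBelow W) x y
    lift W≻t = Star.map λ (s , s<t) → s , W≻t s<t

    middle : ReflClosure _⊢⊣_ p q → Star (StepBelow W) p q
    middle refl     = ε
    middle [ p⊢⊣q ] =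
      (eqv p⊢⊣q , W≻pair (x<tx x⇛*p) (z<tz (reverse id z⇛*q))) ◅ ε

  peak : ∀ {x y y₁} → y ⟶ x → y ⟶ y₁ → Star (StepBelow (y ∷ [])) x y₁
  peak y⟶x y⟶y₁ =
    join-below below-sole below-sole (λ p⊏y q⊏y → below-sole (p⊏y ∷ q⊏y ∷ []))
      (⟶-under y⟶x) (⟶-under y⟶y₁) (local-confluence (_ , y⟶x , y⟶y₁))
    where open WeightOrder using (below-sole)

  -- Cliff x ⊢⊣ y ⟶ y₁, resolved by (ii): x ⟶ x₁ (weight x) then a join
  -- whose left part is below x and right part below y.
  cliff : ∀ {x y y₁} → x ⊢⊣ y → y ⟶ y₁ → Star (StepBelow (x ∷ y ∷ [])) x y₁
  cliff x⊢⊣y y⟶y₁ =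
    let x₁ , x⟶x₁ , x₁-join-y₁ = local-coherence (_ , x⊢⊣y , y⟶y₁) in
    (fwd x⟶x₁ , first-of-two) ◅
    join-below below-first below-second below-each
      (⟶-under x⟶x₁) (⟶-under y⟶y₁) x₁-join-y₁
    where open WeightOrder using (below-first; below-second; below-each; first-of-two)

  -- Mirror x ⟵ y ⊢⊣ w, the reverse of a cliff w ⊢⊣ y ⟶ x.
  mirror : ∀ {x y w} → y ⟶ x → y ⊢⊣ w → Star (StepBelow (y ∷ w ∷ [])) x w
  mirror y⟶x y⊢⊣w =
    let w₁ , w⟶w₁ , w₁-join-x = local-coherence (_ , ⊢⊣-sym y⊢⊣w , y⟶x) in
    join-below below-first below-second below-each
      (⟶-under y⟶x) (⟶-under w⟶w₁) (join-sym w₁-join-x)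
    ◅◅ (bwd w⟶w₁ , second-of-two) ◅ ε
    where open WeightOrder using (below-first; below-second; below-each; second-of-two)

  Valley : Rel A (a ⊔ ℓ₁ ⊔ ℓ₂)
  Valley x z = ∃ λ u → ∃ λ v → Star _⟶_ x u × Star _⊢⊣_ u v × Star (flip _⟶_) v z

  valley-conv : ∀ {x z} → Valley x z → Conv x z
  valley-conv (_ , _ , x⟶*u , u⊢⊣*v , z⟶*v) =
    Star.map fwd x⟶*u ◅◅ Star.map eqv u⊢⊣*v ◅◅ Star.map bwd z⟶*v

  infix 4 _⊴_
  _⊴_ : Rel (List (List A)) (a ⊔ ℓ₂ ⊔ ℓ₃)
  _⊴_ = ReflClosure _≺_

  ⊴-cons : ∀ {w m′ m} → m′ ⊴ m → (w ∷ m′) ⊴ (w ∷ m)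
  ⊴-cons refl     = refl
  ⊴-cons [ m′≺m ] = [ MeasureOrder.prefix (_ ∷ []) m′≺m ]

  ≺-⊴-trans : ∀ {m″ m′ m} → m″ ≺ m′ → m′ ⊴ m → m″ ≺ m
  ≺-⊴-trans m″≺m′ refl     = m″≺m′
  ≺-⊴-trans m″≺m′ [ m′≺m ] = m″≺m′ Plus.++ m′≺m

  ⊴-≺-trans : ∀ {m″ m′ m} → m″ ⊴ m′ → m′ ≺ m → m″ ≺ m
  ⊴-≺-trans refl      m′≺m = m′≺m
  ⊴-≺-trans [ m″≺m′ ] m′≺m = m″≺m′ Plus.++ m′≺m

  splice-first : ∀ {w₁ w₂ x y z} (r : Star (StepBelow w₁) x y) (c : Conv y z) →
                 measure (forget r ◅◅ c) ≺ (w₁ ∷ w₂ ∷ measure c)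
  splice-first r c = subst (_≺ _) (sym (measure-◅◅ (forget r) c))
                           (MeasureOrder.replace-first (forget-below r))

  splice-second : ∀ {w₁ w₂ x y z} (r : Star (StepBelow w₂) x y) (c : Conv y z) →
                  measure (forget r ◅◅ c) ≺ (w₁ ∷ w₂ ∷ measure c)
  splice-second r c = subst (_≺ _) (sym (measure-◅◅ (forget r) c))
                            (MeasureOrder.replace-second (forget-below r))

  -- Every conversion can be turned into a valley of no larger measure, by
  -- well-founded induction on the measure: normalise the tail, then resolve
  -- the first step against the valley (prepend), recursing on the strictly
  -- smaller conversion when a peak, cliff or mirror pattern arises.
  NormalForm : A → A → List (List A) → Set (a ⊔ ℓ₁ ⊔ ℓ₂ ⊔ ℓ₃)
  NormalForm x z m = Σ (Valley x z) λ V → measure (valley-conv V) ⊴ m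

  normalise : ∀ {x z} (c : Conv x z) → Acc _≺_ (measure c) → NormalForm x z (measure c)
  renormalise : ∀ {x z m} → WfRec _≺_ (Acc _≺_) m → (c : Conv x z) → measure c ≺ m →
                NormalForm x z m
  prepend : ∀ {x y z m} (s : Step x y) (V : Valley y z) → WfRec _≺_ (Acc _≺_) m →
            (weight s ∷ measure (valley-conv V)) ⊴ m → NormalForm x z m

  normalise ε       _             = (_ , _ , ε , ε , ε) , refl
  normalise (s ◅ c) (acc smaller) =
    let V , V⊴c = normalise c (smaller MeasureOrder.drop-head) in
    prepend s V smaller (⊴-cons V⊴c)

  renormalise smaller c c≺m =
    let V , V⊴c = normalise c (smaller c≺m) in V , [ ⊴-≺-trans V⊴c c≺m ]

  prepend (fwd x⟶y) (u , v , y⟶*u , u⊢⊣*v , z⟶*v) _ V⊴m =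
    (u , v , x⟶y ◅ y⟶*u , u⊢⊣*v , z⟶*v) , V⊴m
  prepend (eqv x⊢⊣y) (_ , v , ε , y⊢⊣*v , z⟶*v) _ V⊴m =
    (_ , v , ε , x⊢⊣y ◅ y⊢⊣*v , z⟶*v) , V⊴m
  prepend (eqv x⊢⊣y) (u , v , y⟶y₁ ◅ y₁⟶*u , u⊢⊣*v , z⟶*v) smaller V⊴m =
    let rest = valley-conv (u , v , y₁⟶*u , u⊢⊣*v , z⟶*v)
        r    = cliff x⊢⊣y y⟶y₁
    in renormalise smaller (forget r ◅◅ rest) (≺-⊴-trans (splice-first r rest) V⊴m)
  prepend (bwd y⟶x) (_ , _ , ε , ε , z⟶*y) _ V⊴m =
    (_ , _ , ε , ε , y⟶x ◅ z⟶*y) , V⊴m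
  prepend (bwd y⟶x) (_ , v , ε , y⊢⊣w ◅ w⊢⊣*v , z⟶*v) smaller V⊴m =
    let rest = valley-conv (_ , v , ε , w⊢⊣*v , z⟶*v)
        r    = mirror y⟶x y⊢⊣w
    in renormalise smaller (forget r ◅◅ rest) (≺-⊴-trans (splice-second r rest) V⊴m)
  prepend (bwd y⟶x) (u , v , y⟶y₁ ◅ y₁⟶*u , u⊢⊣*v , z⟶*v) smaller V⊴m =
    let rest = valley-conv (u , v , y₁⟶*u , u⊢⊣*v , z⟶*v)
        r    = peak y⟶x y⟶y₁
    in renormalise smaller (forget r ◅◅ rest) (≺-⊴-trans (splice-first r rest) V⊴m)

  conversion : ∀ {x z} → Star (SymClosure _⟶_ ∪ Star _⊢⊣_) x z → Conv x z
  conversion ε                   = ε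
  conversion (inj₁ (inj₁ s) ◅ c) = fwd s ◅ conversion c
  conversion (inj₁ (inj₂ s) ◅ c) = bwd s ◅ conversion c
  conversion (inj₂ s ◅ c)        = Star.map eqv s ◅◅ conversion c

  church-rosser : ChurchRosserModulo _⟶_ (Star _⊢⊣_)
  church-rosser path =
    let c = conversion path in proj₁ (normalise c (≺-wellFounded (measure c)))

corollary2p4 : ∀ {a ℓ₁ ℓ₂ ℓ₃} {A : Set a}
    (_⊢⊣_ : Rel A ℓ₁) (_⟶_ : Rel A ℓ₂) (_⇝_ : Rel A ℓ₃) →
    Symmetric _⊢⊣_ →
    _⇝_ ⇒ _⊢⊣_ →
    WellFoundedChains (_⟶_ ∘ᵣ Star _⇝_) →
    (flip _⟶_ ∘ᵣ _⟶_) ⇒ (Star (_⟶_ ∪ _⇝_) ∘ᵣ ReflClosure _⊢⊣_ ∘ᵣ Star (flip (_⟶_ ∪ _⇝_))) →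
    (_⊢⊣_ ∘ᵣ _⟶_) ⇒ (_⟶_ ∘ᵣ Star (_⟶_ ∪ _⇝_) ∘ᵣ ReflClosure _⊢⊣_ ∘ᵣ Star (flip (_⟶_ ∪ _⇝_))) →
    ChurchRosserModulo _⟶_ (Star _⊢⊣_)
corollary2p4 = ChurchRosser.church-rosser
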